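{- For every even positive integer $n$, there exists an $(n-2)$-regular graph $H$ on $n$ vertices with $C_2(H)=n$.
   Context: All graphs are finite, simple and undirected. A set $S\subseteq V(G)$ is a $2$-dominating set of $G$ if every vertex of $V(G)\setminus S$ has at least $2$ neighbours in $S$. Two sets $U_1,U_2\subseteq V(G)$ form a $2$-coalition if neither $U_1$ nor $U_2$ is a $2$-dominating set of $G$, but $U_1\cup U_2$ is. A $2$-coalition partition of $G$ is a partition $\Theta$ of $V(G)$ into nonempty sets such that every set of $\Theta$ either is a $2$-dominating set of $G$ with exactly $2$ elements, or forms a $2$-coalition with some other set of $\Theta$. The $2$-coalition number $C_2(G)$ is the maximum number of sets in a $2$-coalition partition of $G$. -}

module Defs where

open import Data.Nat using (ℕ; _≤_; _∸_)
open import Data.Bool using (Bool; true; false; T)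
open import Data.Fin using (Fin; _≟_)
open import Data.Fin.Subset using (Subset; _∈_; _∉_; _∪_; _∩_; ∣_∣)
open import Data.Vec using (tabulate)
open import Data.Product using (_×_; Σ-syntax)
open import Data.Sum using (_⊎_)
open import Relation.Nullary using (¬_; does)
open import Relation.Binary.PropositionalEquality using (_≡_; _≢_)
open import Function using (Surjective)
open import Relation.Binary.PropositionalEquality using (_≡_)

record Graph (n : ℕ) : Set where
  field
    adj   : Fin n → Fin n → Bool
    sym   : ∀ u v → adj u v ≡ adj v u
    irrefl : ∀ v → adj v v ≡ false
open Graph public

N : ∀ {n} → Graph n → Fin n → Subset n
N G v = tabulate (adj G v)

deg : ∀ {n} → Graph n → Fin n → ℕ
deg G v = ∣ N G v ∣

Regular : ∀ {n} → Graph n → ℕ → Set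
Regular G r = ∀ v → deg G v ≡ r

TwoDominating : ∀ {n} → Graph n → Subset n → Set
TwoDominating G S = ∀ v → v ∉ S → 2 ≤ ∣ N G v ∩ S ∣

TwoCoalition : ∀ {n} → Graph n → Subset n → Subset n → Set
TwoCoalition G U₁ U₂ =
  ¬ TwoDominating G U₁ × ¬ TwoDominating G U₂ × TwoDominating G (U₁ ∪ U₂)

-- A partition of V(G) into k nonempty sets is encoded by a surjection
-- f : Fin n → Fin k; the i-th set is the preimage of i.
Part : ∀ {n k} → (Fin n → Fin k) → Fin k → Subset n
Part f i = tabulate (λ v → does (f v ≟ i))

IsTwoCoalitionPartition : ∀ {n} → Graph n → (k : ℕ) → (Fin n → Fin k) → Set
IsTwoCoalitionPartition {n} G k f =
  Surjective _≡_ _≡_ f ×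
  (∀ i → (TwoDominating G (Part f i) × ∣ Part f i ∣ ≡ 2)
         ⊎ (Σ[ j ∈ Fin k ] (j ≢ i × TwoCoalition G (Part f i) (Part f j))))

HasTwoCoalitionPartition : ∀ {n} → Graph n → ℕ → Set
HasTwoCoalitionPartition {n} G k = Σ[ f ∈ (Fin n → Fin k) ] IsTwoCoalitionPartition G k f

C₂≡ : ∀ {n} → Graph n → ℕ → Set
C₂≡ G m = HasTwoCoalitionPartition G m × (∀ k → HasTwoCoalitionPartition G k → k ≤ m)

-- Take H to be the cocktail-party graph: K_n minus a perfect matching {i, p i},
-- which is (n − 2)-regular. No singleton is 2-dominating in any graph with a
-- second vertex, while each matched pair {i, p i} is 2-dominating in H, since
-- every vertex outside it is adjacent to both ends. So the partition of V(H)
-- into singletons is a 2-coalition partition with n sets, and no partition of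
-- n vertices into nonempty sets has more than n of them.
module Submission where

open import Defs hiding (sym)
open import Data.Nat as ℕ using (ℕ; _<_; _∸_; _≤_)
open import Data.Nat.Divisibility using (_∣_; divides)
open import Data.Nat.Properties using (≤-trans; ≤-reflexive; n≮n)
open import Data.Product using (_×_; Σ-syntax; _,_; proj₁; proj₂)
open import Data.Sum using (_⊎_; inj₁; inj₂)
open import Data.Bool using (Bool; true; false; not)
open import Data.Fin using (Fin; zero; suc)
open import Data.Fin.Properties using (injective⇒≤; suc-injective)
open import Data.Fin.Subset using (Subset; inside; outside; _∈_; _∉_; _∪_; _∩_; ∣_∣; _⊆_; ⁅_⁆; ∁; ⊥)
open import Data.Fin.Subset.Properties
  using (x∈⁅x⁆; x∈⁅y⁆⇒x≡y; x≢y⇒x∉⁅y⁆; ∣⁅x⁆∣≡1; p⊆q⇒∣p∣≤∣q∣; ∣p∩q∣≤∣q∣;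
         x∈p∪q⁻; x∈p∪q⁺; x∈p∩q⁺; x∉p⇒x∈∁p; ∣∁p∣≡n∸∣p∣; ∪-identityˡ; ∪-identityʳ)
open import Data.Vec using (_∷_; lookup; tabulate)
open import Data.Vec.Properties
  using (lookup-map; lookup-replicate; tabulate∘lookup; tabulate-cong; []=⇒lookup; lookup⇒[]=)
open import Function using (id; _∘_; Surjective)
open import Relation.Nullary using (¬_; contradiction)
open import Relation.Binary.PropositionalEquality
  using (_≡_; _≢_; refl; sym; trans; cong; subst₂; module ≡-Reasoning)

∣⁅x⁆∪⁅y⁆∣≡2 : ∀ {n} {x y : Fin n} → x ≢ y → ∣ ⁅ x ⁆ ∪ ⁅ y ⁆ ∣ ≡ 2
∣⁅x⁆∪⁅y⁆∣≡2 {x = zero}  {zero}  x≢y = contradiction refl x≢y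
∣⁅x⁆∪⁅y⁆∣≡2 {x = zero}  {suc y} _   = cong ℕ.suc (trans (cong ∣_∣ (∪-identityˡ ⁅ y ⁆)) (∣⁅x⁆∣≡1 y))
∣⁅x⁆∪⁅y⁆∣≡2 {x = suc x} {zero}  _   = cong ℕ.suc (trans (cong ∣_∣ (∪-identityʳ ⁅ x ⁆)) (∣⁅x⁆∣≡1 x))
∣⁅x⁆∪⁅y⁆∣≡2 {x = suc x} {suc y} x≢y = ∣⁅x⁆∪⁅y⁆∣≡2 (x≢y ∘ cong suc)

lookup-∁ : ∀ {n} (s : Subset n) v → lookup (∁ s) v ≡ not (lookup s v)
lookup-∁ s v = lookup-map v not s

lookup-≡-if-∈⇔∈ : ∀ {n} {p q : Subset n} {x y : Fin n} →
  (x ∈ p → y ∈ q) → (y ∈ q → x ∈ p) → lookup p x ≡ lookup q y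
lookup-≡-if-∈⇔∈ {p = p} {q} {x} {y} to from with lookup p x in px | lookup q y in qy
... | true  | true  = refl
... | false | false = refl
... | true  | false with () ← trans (sym ([]=⇒lookup (to (lookup⇒[]= x p px)))) qy
... | false | true  with () ← trans (sym ([]=⇒lookup (from (lookup⇒[]= y q qy)))) px

Part-id≡⁅⁆ : ∀ {n} (i : Fin n) → Part id i ≡ ⁅ i ⁆
Part-id≡⁅⁆ {ℕ.suc n} zero    = cong (inside ∷_) (begin
  tabulate (λ _ → outside)  ≡⟨ tabulate-cong (λ v → sym (lookup-replicate v outside)) ⟩
  tabulate (lookup ⊥)       ≡⟨ tabulate∘lookup ⊥ ⟩
  ⊥                         ∎)
  where open ≡-Reasoning
Part-id≡⁅⁆           (suc i) = cong (outside ∷_) (Part-id≡⁅⁆ i)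

surjective⇒≥ : ∀ {m k} {f : Fin m → Fin k} → Surjective _≡_ _≡_ f → k ≤ m
surjective⇒≥ {m} {k} {f} surj = injective⇒≤ {f = section} section-injective
  where
  section : Fin k → Fin m
  section = proj₁ ∘ surj
  f∘section : ∀ y → f (section y) ≡ y
  f∘section y = proj₂ (surj y) refl
  section-injective : ∀ {x y} → section x ≡ section y → x ≡ y
  section-injective {x} {y} e = trans (sym (f∘section x)) (trans (cong f e) (f∘section y))

module _ {n} (G : Graph n) where

  ⁅⁆-¬twoDominating : ∀ {i j : Fin n} → j ≢ i → ¬ TwoDominating G ⁅ i ⁆
  ⁅⁆-¬twoDominating {i} {j} j≢i dom = n≮n 1 (≤-trans (dom j (x≢y⇒x∉⁅y⁆ j≢i)) ∣N∩⁅i⁆∣≤1)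
    where
    ∣N∩⁅i⁆∣≤1 : ∣ N G j ∩ ⁅ i ⁆ ∣ ≤ 1
    ∣N∩⁅i⁆∣≤1 = ≤-trans (∣p∩q∣≤∣q∣ (N G j) ⁅ i ⁆) (≤-reflexive (∣⁅x⁆∣≡1 i))

  ⁅⁆∪⁅⁆-twoDominating : ∀ {x y : Fin n} → x ≢ y →
    (∀ v → v ∉ ⁅ x ⁆ ∪ ⁅ y ⁆ → x ∈ N G v × y ∈ N G v) → TwoDominating G (⁅ x ⁆ ∪ ⁅ y ⁆)
  ⁅⁆∪⁅⁆-twoDominating {x} {y} x≢y adjacent v v∉ =
    ≤-trans (≤-reflexive (sym (∣⁅x⁆∪⁅y⁆∣≡2 x≢y))) (p⊆q⇒∣p∣≤∣q∣ ⊆N∩)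
    where
    ⊆N∩ : ⁅ x ⁆ ∪ ⁅ y ⁆ ⊆ N G v ∩ (⁅ x ⁆ ∪ ⁅ y ⁆)
    ⊆N∩ {w} w∈ with x∈p∪q⁻ ⁅ x ⁆ ⁅ y ⁆ w∈
    ... | inj₁ w∈⁅x⁆ rewrite x∈⁅y⁆⇒x≡y x w∈⁅x⁆ = x∈p∩q⁺ (proj₁ (adjacent v v∉) , w∈)
    ... | inj₂ w∈⁅y⁆ rewrite x∈⁅y⁆⇒x≡y y w∈⁅y⁆ = x∈p∩q⁺ (proj₂ (adjacent v v∉) , w∈)

  singletons-isTwoCoalitionPartition :
    (∀ i → Σ[ j ∈ Fin n ] (j ≢ i × TwoDominating G (⁅ i ⁆ ∪ ⁅ j ⁆))) →
    IsTwoCoalitionPartition G n id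
  singletons-isTwoCoalitionPartition partner = (λ i → i , id) , inj₂ ∘ coalition
    where
    coalition : ∀ i → Σ[ j ∈ Fin n ] (j ≢ i × TwoCoalition G (Part id i) (Part id j))
    coalition i with partner i
    ... | j , j≢i , dom = j , j≢i ,
      subst₂ (TwoCoalition G) (sym (Part-id≡⁅⁆ i)) (sym (Part-id≡⁅⁆ j))
        (⁅⁆-¬twoDominating j≢i , ⁅⁆-¬twoDominating (j≢i ∘ sym) , dom)

  C₂≡order : HasTwoCoalitionPartition G n → C₂≡ G n
  C₂≡order partition = partition , λ _ (_ , surj , _) → surjective⇒≥ surj

module CocktailParty {n} (p : Fin n → Fin n)
  (p-involutive : ∀ i → p (p i) ≡ i) (p-fixedPointFree : ∀ i → p i ≢ i) where

  pair : Fin n → Subset n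
  pair i = ⁅ i ⁆ ∪ ⁅ p i ⁆

  ∈-pair⁺ : ∀ {v i} → v ≡ i ⊎ v ≡ p i → v ∈ pair i
  ∈-pair⁺ (inj₁ refl) = x∈p∪q⁺ (inj₁ (x∈⁅x⁆ _))
  ∈-pair⁺ (inj₂ refl) = x∈p∪q⁺ (inj₂ (x∈⁅x⁆ _))

  ∈-pair⁻ : ∀ {v i} → v ∈ pair i → v ≡ i ⊎ v ≡ p i
  ∈-pair⁻ {i = i} v∈ with x∈p∪q⁻ ⁅ i ⁆ ⁅ p i ⁆ v∈
  ... | inj₁ v∈⁅i⁆  = inj₁ (x∈⁅y⁆⇒x≡y i v∈⁅i⁆)
  ... | inj₂ v∈⁅pi⁆ = inj₂ (x∈⁅y⁆⇒x≡y (p i) v∈⁅pi⁆)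

  pair-sym : ∀ {u v} → v ∈ pair u → u ∈ pair v
  pair-sym {u} v∈ with ∈-pair⁻ v∈
  ... | inj₁ refl = ∈-pair⁺ (inj₁ refl)
  ... | inj₂ refl = ∈-pair⁺ (inj₂ (sym (p-involutive u)))

  pair-p : ∀ {v i} → v ∈ pair (p i) → v ∈ pair i
  pair-p {i = i} v∈ with ∈-pair⁻ v∈
  ... | inj₁ v≡pi  = ∈-pair⁺ (inj₂ v≡pi)
  ... | inj₂ v≡ppi = ∈-pair⁺ (inj₁ (trans v≡ppi (p-involutive i)))

  adjacent? : Fin n → Fin n → Bool
  adjacent? u = lookup (∁ (pair u))

  adjacent?-sym : ∀ u v → adjacent? u v ≡ adjacent? v u
  adjacent?-sym u v = begin
    lookup (∁ (pair u)) v     ≡⟨ lookup-∁ (pair u) v ⟩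
    not (lookup (pair u) v)   ≡⟨ cong not (lookup-≡-if-∈⇔∈ (pair-sym {u}) (pair-sym {v})) ⟩
    not (lookup (pair v) u)   ≡⟨ sym (lookup-∁ (pair v) u) ⟩
    lookup (∁ (pair v)) u     ∎
    where open ≡-Reasoning

  adjacent?-irrefl : ∀ v → adjacent? v v ≡ false
  adjacent?-irrefl v = trans (lookup-∁ (pair v) v) (cong not ([]=⇒lookup (∈-pair⁺ {v} (inj₁ refl))))

  graph : Graph n
  graph = record { adj = adjacent? ; sym = adjacent?-sym ; irrefl = adjacent?-irrefl }

  N-graph : ∀ v → N graph v ≡ ∁ (pair v)
  N-graph v = tabulate∘lookup (∁ (pair v))

  regular : Regular graph (n ∸ 2)
  regular v = begin
    ∣ N graph v ∣         ≡⟨ cong ∣_∣ (N-graph v) ⟩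
    ∣ ∁ (pair v) ∣        ≡⟨ ∣∁p∣≡n∸∣p∣ (pair v) ⟩
    n ∸ ∣ pair v ∣        ≡⟨ cong (n ∸_) (∣⁅x⁆∪⁅y⁆∣≡2 (p-fixedPointFree v ∘ sym)) ⟩
    n ∸ 2                 ∎
    where open ≡-Reasoning

  pair-twoDominating : ∀ i → TwoDominating graph (pair i)
  pair-twoDominating i = ⁅⁆∪⁅⁆-twoDominating graph (p-fixedPointFree i ∘ sym) adjacent
    where
    ∈N : ∀ {u v} → u ∉ pair v → u ∈ N graph v
    ∈N {u} {v} u∉ rewrite N-graph v = x∉p⇒x∈∁p u∉
    adjacent : ∀ v → v ∉ pair i → i ∈ N graph v × p i ∈ N graph v
    adjacent v v∉ = ∈N (v∉ ∘ pair-sym) , ∈N (v∉ ∘ pair-p ∘ pair-sym)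

partner : ∀ q → Fin (q ℕ.* 2) → Fin (q ℕ.* 2)
partner (ℕ.suc q) zero          = suc zero
partner (ℕ.suc q) (suc zero)    = zero
partner (ℕ.suc q) (suc (suc i)) = suc (suc (partner q i))

partner-involutive : ∀ q i → partner q (partner q i) ≡ i
partner-involutive (ℕ.suc q) zero          = refl
partner-involutive (ℕ.suc q) (suc zero)    = refl
partner-involutive (ℕ.suc q) (suc (suc i)) = cong (suc ∘ suc) (partner-involutive q i)

partner-fixedPointFree : ∀ q i → partner q i ≢ i
partner-fixedPointFree (ℕ.suc q) zero          ()
partner-fixedPointFree (ℕ.suc q) (suc zero)    ()
partner-fixedPointFree (ℕ.suc q) (suc (suc i)) e =
  partner-fixedPointFree q i (suc-injective (suc-injective e))

lemma5 : (n : ℕ) → 0 < n → 2 ∣ n →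
    Σ[ H ∈ Graph n ] (Regular H (n ∸ 2) × C₂≡ H n)
lemma5 n _ (divides q refl) =
  graph , regular ,
  C₂≡order graph (id , singletons-isTwoCoalitionPartition graph
                         (λ i → partner q i , partner-fixedPointFree q i , pair-twoDominating i))
  where open CocktailParty (partner q) (partner-involutive q) (partner-fixedPointFree q)
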